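{- Let $S$ be a sorting sequence with $r>1$ distinct values and multiplicities $p_1,\dots,p_r$, and $c=\gcd(p_1,\dots,p_r)$. There exists a minimal integer $\gamma$, divisible by $c$, such that for every integer $f>\gamma$ divisible by $c$ there exists a general solution for $S$ with $f$ fake coins.
   Context: A sorting sequence of length $p$ is a non-decreasing sequence of $p$ non-negative integers beginning with $0$ in which each entry equals the previous one or exceeds it by $1$ (recording the outcome of sorting $p$ piles of coins by weight, fake coins lighter). If its distinct entries are $0,\dots,r-1$, let $p_i\ge1$ be the number of entries equal to $i-1$. A general solution with $f$ fake coins is an integer tuple $(f_1,\dots,f_r)$ with $0\le f_1<\dots<f_r$ and $\sum_ip_if_i=f$. -}

module Defs where

open import Data.Nat using (ℕ; zero; suc; _+_; _*_; _⊔_; _<_)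
open import Data.Nat.GCD using (gcd)
open import Data.Fin using (Fin; toℕ) renaming (_<_ to _<ᶠ_)
open import Data.List using (List; []; _∷_; length; filter; foldr; map; allFin)
open import Data.Nat.ListAction using (sum)
open import Data.Product using (Σ; _×_)
open import Data.Sum using (_⊎_)
open import Data.Empty using (⊥)
open import Data.Integer using (ℤ; +_)
import Data.Nat.Properties as ℕP
open import Relation.Binary.PropositionalEquality using (_≡_)

-- The tail of a sorting sequence whose previous entry is a:
-- each entry equals the previous one or exceeds it by 1.
data SortingTail : ℕ → List ℕ → Set where
  []ᵗ  : ∀ {a} → SortingTail a []
  same : ∀ {a xs} → SortingTail a xs → SortingTail a (a ∷ xs)
  step : ∀ {a xs} → SortingTail (suc a) xs → SortingTail a (suc a ∷ xs)

IsSortingSeq : List ℕ → Set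
IsSortingSeq []       = ⊥
IsSortingSeq (x ∷ xs) = (x ≡ 0) × SortingTail x xs

-- Number r of distinct values (the entries of a sorting sequence are
-- exactly 0, …, max, so r = max + 1).
numValues : List ℕ → ℕ
numValues S = suc (foldr _⊔_ 0 S)

count : List ℕ → ℕ → ℕ
count S v = length (filter (λ x → x ℕP.≟ v) S)

-- p_i for i = 1..r, indexed by Fin r (index i stands for value toℕ i)
mult : (S : List ℕ) → Fin (numValues S) → ℕ
mult S i = count S (toℕ i)

gcdMults : List ℕ → ℕ
gcdMults S = foldr (λ i acc → gcd (mult S i) acc) 0 (allFin (numValues S))

StrictlyIncreasing : ∀ {r} → (Fin r → ℕ) → Set
StrictlyIncreasing g = ∀ i j → i <ᶠ j → g i < g j

weightedSum : (S : List ℕ) → (Fin (numValues S) → ℕ) → ℕ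
weightedSum S g = sum (map (λ i → mult S i * g i) (allFin (numValues S)))

-- A general solution for S with f fake coins: integers 0 ≤ f_1 < … < f_r
-- (non-negativity via ℕ) with Σ p_i f_i = f.
GeneralSolution : List ℕ → ℤ → Set
GeneralSolution S f =
  Σ (Fin (numValues S) → ℕ) λ g → StrictlyIncreasing g × (+ weightedSum S g ≡ f)

-- Bézout's identity gives two vectors x, y over ℕ with Σ pᵢxᵢ = Σ pᵢyᵢ + c. Adding a steep
-- staircase K·i to both makes them strictly increasing, so the sums attained by non-decreasing
-- vectors (a submonoid of ℕ) contain two consecutive multiples Mc and (M+1)c, hence every
-- multiple of c from M²c on. Adding the strictly increasing vector (0, 1, …, r−1) shows that
-- all large multiples of c are attained by general solutions. Solvability of a given f is
-- decidable (all entries are at most f), and 0 is not attained when r > 1, so a largest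
-- unattained multiple k₀c exists; it is the least threshold γ.
module Submission where

module SortingSequences where

  open import Defs
  open import Data.Nat using (ℕ; suc; _≤_; _<_; _⊔_; z≤n; s≤s)
  open import Data.Nat.Properties
    using (_≟_; ≤-antisym; ≤-trans; ≤-pred; ≤∧≢⇒<; n≤1+n; m≤m⊔n; m≤n⇒m⊔n≡n; ⊔-identityʳ)
  open import Data.List using (_∷_; foldr; length)
  open import Data.List.Membership.Propositional using (_∈_)
  open import Data.List.Membership.Propositional.Properties using (∈-filter⁺)
  open import Data.List.Relation.Unary.Any using (here; there)
  open import Data.Fin.Properties using (toℕ<n)
  open import Data.Product using (_,_)
  open import Relation.Nullary using (yes; no)
  open import Relation.Binary.PropositionalEquality using (refl; sym; subst)
  open import Function using (_∘_)

  ∈⇒length-positive : ∀ {v : ℕ} {xs} → v ∈ xs → 0 < length xs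
  ∈⇒length-positive {xs = _ ∷ _} _ = s≤s z≤n

  ∈⇒count-positive : ∀ {v S} → v ∈ S → 0 < count S v
  ∈⇒count-positive {v} v∈S = ∈⇒length-positive (∈-filter⁺ (_≟ v) v∈S refl)

  sortingTail-covers : ∀ {a xs v} → SortingTail a xs →
    a ≤ v → v ≤ a ⊔ foldr _⊔_ 0 xs → v ∈ a ∷ xs
  sortingTail-covers {a} {v = v} []ᵗ a≤v v≤max =
    here (≤-antisym (subst (v ≤_) (⊔-identityʳ a) v≤max) a≤v)
  sortingTail-covers {a} {v = v} (same t) a≤v v≤max =
    there (sortingTail-covers t a≤v (subst (v ≤_) (m≤n⇒m⊔n≡n (m≤m⊔n a _)) v≤max))
  sortingTail-covers {a} {_ ∷ xs} {v} (step t) a≤v v≤max with v ≟ a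
  ... | yes refl = here refl
  ... | no v≢a = there (sortingTail-covers t (≤∧≢⇒< a≤v (v≢a ∘ sym))
          (subst (v ≤_) (m≤n⇒m⊔n≡n (≤-trans (n≤1+n a) (m≤m⊔n (suc a) (foldr _⊔_ 0 xs)))) v≤max))

  mult-positive : ∀ S → IsSortingSeq S → ∀ i → 0 < mult S i
  mult-positive (_ ∷ _) (refl , t) i =
    ∈⇒count-positive (sortingTail-covers t z≤n (≤-pred (toℕ<n i)))

module WeightedSums where

  open import Defs using (StrictlyIncreasing)
  open import Data.Nat
    using (ℕ; zero; suc; _+_; _*_; _∸_; _≤_; _<_; z≤n; s≤s; z<s; _⊔_; _/_; _%_; NonZero; >-nonZero; ≢-nonZero)
  open import Data.Nat.Properties
  open import Data.Nat.DivMod using (m≡m%n+[m/n]*n; m%n<n)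
  open import Data.Nat.Divisibility using (_∣_; divides; ∣-trans; ∣m∣n⇒∣m+n; ∣m⇒∣m*n; 0∣⇒≡0)
  open import Data.Nat.GCD using (gcd; gcd[m,n]∣m; gcd[m,n]∣n; gcd-GCD; module Bézout)
  open import Data.Nat.Tactic.RingSolver using (solve-∀)
  open import Data.Fin using (Fin; toℕ) renaming (zero to fz; suc to fs; _<_ to _<ᶠ_)
  open import Data.Fin.Properties using (all?) renaming (_<?_ to _<ᶠ?_)
  open import Data.Vec.Functional using (_∷_; head; tail)
  open import Data.Product using (∃; ∃₂; ∃-syntax; _×_; _,_; proj₂)
  open import Data.Sum using (inj₁; inj₂)
  open import Relation.Nullary using (¬_; Dec; yes; no; contradiction)
  open import Relation.Nullary.Decidable using (map′; _×-dec_; _→-dec_)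
  open import Relation.Binary.PropositionalEquality
  open import Function using (_∘_)

  dot : ∀ {n} → (Fin n → ℕ) → (Fin n → ℕ) → ℕ
  dot {zero}  p g = 0
  dot {suc n} p g = head p * head g + dot (tail p) (tail g)

  gcdᶠ : ∀ {n} → (Fin n → ℕ) → ℕ
  gcdᶠ {zero}  p = 0
  gcdᶠ {suc n} p = gcd (head p) (gcdᶠ (tail p))

  dot-cong : ∀ {n} (p : Fin n → ℕ) {g h} → (∀ i → g i ≡ h i) → dot p g ≡ dot p h
  dot-cong {zero}  p g≗h = refl
  dot-cong {suc n} p g≗h = cong₂ _+_ (cong (head p *_) (g≗h fz)) (dot-cong (tail p) (g≗h ∘ fs))

  dot-zero : ∀ {n} (p : Fin n → ℕ) → dot p (λ _ → 0) ≡ 0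
  dot-zero {zero}  p = refl
  dot-zero {suc n} p = cong₂ _+_ (*-zeroʳ (head p)) (dot-zero (tail p))

  dot-+ : ∀ {n} (p g h : Fin n → ℕ) → dot p (λ i → g i + h i) ≡ dot p g + dot p h
  dot-+ {zero}  p g h = refl
  dot-+ {suc n} p g h =
    trans (cong (head p * (head g + head h) +_) (dot-+ (tail p) (tail g) (tail h)))
          (lemma (head p) (head g) (head h) (dot (tail p) (tail g)) (dot (tail p) (tail h)))
    where
    lemma : ∀ a b c x y → a * (b + c) + (x + y) ≡ a * b + x + (a * c + y)
    lemma = solve-∀

  dot-* : ∀ {n} (p : Fin n → ℕ) v g → dot p (λ i → v * g i) ≡ v * dot p g
  dot-* {zero}  p v g = sym (*-zeroʳ v)
  dot-* {suc n} p v g =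
    trans (cong (head p * (v * head g) +_) (dot-* (tail p) v (tail g)))
          (lemma (head p) v (head g) (dot (tail p) (tail g)))
    where
    lemma : ∀ a v b x → a * (v * b) + v * x ≡ v * (a * b + x)
    lemma = solve-∀

  dot-linear : ∀ {n} (p : Fin n → ℕ) s x t y →
    dot p (λ i → s * x i + t * y i) ≡ s * dot p x + t * dot p y
  dot-linear p s x t y =
    trans (dot-+ p _ _) (cong₂ _+_ (dot-* p s x) (dot-* p t y))

  gcdᶠ∣ : ∀ {n} (p : Fin n → ℕ) i → gcdᶠ p ∣ p i
  gcdᶠ∣ {suc n} p fz     = gcd[m,n]∣m (head p) (gcdᶠ (tail p))
  gcdᶠ∣ {suc n} p (fs i) = ∣-trans (gcd[m,n]∣n (head p) (gcdᶠ (tail p))) (gcdᶠ∣ (tail p) i)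

  ∣⇒∣dot : ∀ {n d} (p : Fin n → ℕ) g → (∀ i → d ∣ p i) → d ∣ dot p g
  ∣⇒∣dot {zero}  p g d∣p = divides 0 refl
  ∣⇒∣dot {suc n} p g d∣p =
    ∣m∣n⇒∣m+n (∣m⇒∣m*n (head g) (d∣p fz)) (∣⇒∣dot (tail p) (tail g) (d∣p ∘ fs))

  ≤-dot : ∀ {n} (p : Fin n → ℕ) → (∀ i → 0 < p i) → ∀ g i → g i ≤ dot p g
  ≤-dot {suc n} p p>0 g fz =
    ≤-trans (m≤n*m (head g) (head p) {{>-nonZero (p>0 fz)}}) (m≤m+n _ _)
  ≤-dot {suc n} p p>0 g (fs i) =
    ≤-trans (≤-dot (tail p) (p>0 ∘ fs) (tail g) i) (m≤n+m _ _)

  bezout-ℕ : ∀ a b → ∃[ u₁ ] ∃[ v₁ ] ∃[ u₂ ] ∃[ v₂ ]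
    u₁ * a + v₁ * b ≡ u₂ * a + v₂ * b + gcd a b
  bezout-ℕ a b with Bézout.identity (gcd-GCD a b)
  ... | Bézout.+- x y eq =
    x , 0 , 0 , y , trans (+-identityʳ (x * a)) (trans (sym eq) (+-comm (gcd a b) (y * b)))
  ... | Bézout.-+ x y eq =
    0 , y , x , 0 , trans (sym eq) (trans (+-comm (gcd a b) (x * a))
                                          (cong (_+ gcd a b) (sym (+-identityʳ (x * a)))))

  bezout : ∀ {n} (p : Fin n → ℕ) → ∃₂ λ x y → dot p x ≡ dot p y + gcdᶠ p
  bezout {zero} p = (λ ()) , (λ ()) , refl
  -- Substitute g = X − Y into u₁a + v₁g = u₂a + v₂g + gcd a g.
  bezout {suc n} p with bezout (tail p) | bezout-ℕ (head p) (gcdᶠ (tail p))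
  ... | x , y , X≡Y+g | u₁ , v₁ , u₂ , v₂ , eq =
    u₁ ∷ (λ i → v₁ * x i + v₂ * y i) , u₂ ∷ (λ i → v₂ * x i + v₁ * y i) ,
    (begin
      a * u₁ + dot q (λ i → v₁ * x i + v₂ * y i)  ≡⟨ cong (a * u₁ +_) (dot-linear q v₁ x v₂ y) ⟩
      a * u₁ + (v₁ * X + v₂ * Y)                   ≡⟨ cong (λ z → a * u₁ + (v₁ * z + v₂ * Y)) X≡Y+g ⟩
      a * u₁ + (v₁ * (Y + g) + v₂ * Y)             ≡⟨ regroupˡ a u₁ v₁ v₂ Y g ⟩
      u₁ * a + v₁ * g + (v₁ * Y + v₂ * Y)          ≡⟨ cong (_+ (v₁ * Y + v₂ * Y)) eq ⟩
      u₂ * a + v₂ * g + gcd a g + (v₁ * Y + v₂ * Y) ≡⟨ regroupʳ a u₂ v₂ v₁ Y g (gcd a g) ⟩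
      a * u₂ + (v₂ * (Y + g) + v₁ * Y) + gcd a g   ≡⟨ cong (λ z → a * u₂ + (v₂ * z + v₁ * Y) + gcd a g) (sym X≡Y+g) ⟩
      a * u₂ + (v₂ * X + v₁ * Y) + gcd a g         ≡⟨ cong (λ z → a * u₂ + z + gcd a g) (sym (dot-linear q v₂ x v₁ y)) ⟩
      a * u₂ + dot q (λ i → v₂ * x i + v₁ * y i) + gcd a g ∎)
    where
    open ≡-Reasoning
    a = head p
    q = tail p
    g = gcdᶠ q
    X = dot q x
    Y = dot q y
    regroupˡ : ∀ a u v w Y g → a * u + (v * (Y + g) + w * Y) ≡ u * a + v * g + (v * Y + w * Y)
    regroupˡ = solve-∀
    regroupʳ : ∀ a u v w Y g d →
      u * a + v * g + d + (w * Y + v * Y) ≡ a * u + (v * (Y + g) + w * Y) + d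
    regroupʳ = solve-∀

  bounded : ∀ {n} (x : Fin n → ℕ) → ∃ λ K → ∀ i → x i < K
  bounded {zero}  x = 0 , λ ()
  bounded {suc n} x with bounded (tail x)
  ... | K , x<K = suc (head x) ⊔ K , λ { fz     → m≤m⊔n (suc (head x)) K
                                       ; (fs i) → m<n⇒m<o⊔n (suc (head x)) (x<K i) }

  staircase : ∀ {n} → ℕ → Fin n → ℕ
  staircase K i = K * toℕ i

  +staircase-strictlyIncreasing : ∀ {n} {x : Fin n → ℕ} {K} → (∀ i → x i < K) →
    StrictlyIncreasing (λ i → x i + staircase K i)
  +staircase-strictlyIncreasing {x = x} {K} x<K i j i<j = begin-strict
    x i + K * toℕ i  <⟨ +-monoˡ-< (K * toℕ i) (x<K i) ⟩
    K + K * toℕ i    ≡⟨ *-suc K (toℕ i) ⟨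
    K * suc (toℕ i)  ≤⟨ *-monoʳ-≤ K i<j ⟩
    K * toℕ j        ≤⟨ m≤n+m _ _ ⟩
    x j + K * toℕ j  ∎
    where open ≤-Reasoning

  NonDecreasing : ∀ {n} → (Fin n → ℕ) → Set
  NonDecreasing g = ∀ i j → i <ᶠ j → g i ≤ g j

  Solvable : ∀ {n} → (Fin n → ℕ) → ℕ → Set
  Solvable p m = ∃ λ g → StrictlyIncreasing g × dot p g ≡ m

  WeaklySolvable : ∀ {n} → (Fin n → ℕ) → ℕ → Set
  WeaklySolvable p m = ∃ λ g → NonDecreasing g × dot p g ≡ m

  solvable⇒weaklySolvable : ∀ {n} {p : Fin n → ℕ} {m} → Solvable p m → WeaklySolvable p m
  solvable⇒weaklySolvable (g , inc , eq) = g , (λ i j i<j → <⇒≤ (inc i j i<j)) , eq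

  solvable⇒gcdᶠ∣ : ∀ {n} (p : Fin n → ℕ) {m} → Solvable p m → gcdᶠ p ∣ m
  solvable⇒gcdᶠ∣ p (g , _ , refl) = ∣⇒∣dot p g (gcdᶠ∣ p)

  weaklySolvable-zero : ∀ {n} (p : Fin n → ℕ) → WeaklySolvable p 0
  weaklySolvable-zero p = (λ _ → 0) , (λ _ _ _ → z≤n) , dot-zero p

  weaklySolvable-+ : ∀ {n} {p : Fin n → ℕ} {a b} →
    WeaklySolvable p a → WeaklySolvable p b → WeaklySolvable p (a + b)
  weaklySolvable-+ {p = p} (g , g↑ , refl) (h , h↑ , refl) =
    (λ i → g i + h i) , (λ i j i<j → +-mono-≤ (g↑ i j i<j) (h↑ i j i<j)) , dot-+ p g h

  solvable-+ : ∀ {n} {p : Fin n → ℕ} {a b} →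
    Solvable p a → WeaklySolvable p b → Solvable p (a + b)
  solvable-+ {p = p} (g , g↑ , refl) (h , h↑ , refl) =
    (λ i → g i + h i) , (λ i j i<j → +-mono-<-≤ (g↑ i j i<j) (h↑ i j i<j)) , dot-+ p g h

  +staircase-solvable : ∀ {n} (p : Fin n → ℕ) {x K} → (∀ i → x i < K) →
    Solvable p (dot p x + dot p (staircase K))
  +staircase-solvable p {x} {K} x<K =
    (λ i → x i + staircase K i) , +staircase-strictlyIncreasing x<K , dot-+ p x (staircase K)

  consecutive-multiples : ∀ {n} (p : Fin n → ℕ) → ∃ λ M →
    WeaklySolvable p (M * gcdᶠ p) × WeaklySolvable p (M * gcdᶠ p + gcdᶠ p)
  consecutive-multiples p with bezout p
  ... | x , y , X≡Y+c with bounded (λ i → x i + y i)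
  ... | K , x+y<K = M , subst (WeaklySolvable p) Y+S≡Mc (solvable⇒weaklySolvable Y+S-solvable)
                      , subst (WeaklySolvable p) X+S≡Mc+c (solvable⇒weaklySolvable X+S-solvable)
    where
    S = dot p (staircase K)
    c = gcdᶠ p
    Y+S-solvable : Solvable p (dot p y + S)
    Y+S-solvable = +staircase-solvable p (λ i → ≤-<-trans (m≤n+m (y i) (x i)) (x+y<K i))
    X+S-solvable : Solvable p (dot p x + S)
    X+S-solvable = +staircase-solvable p (λ i → ≤-<-trans (m≤m+n (x i) (y i)) (x+y<K i))
    open _∣_ (solvable⇒gcdᶠ∣ p Y+S-solvable) renaming (quotient to M; equality to Y+S≡Mc)
    swap : ∀ a b d → a + b + d ≡ a + d + b
    swap = solve-∀
    X+S≡Mc+c : dot p x + S ≡ M * c + c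
    X+S≡Mc+c = trans (cong (_+ S) X≡Y+c) (trans (swap (dot p y) c S) (cong (_+ c) Y+S≡Mc))

  -- Writing t = q(M+1) + r with r ≤ M exhibits (M² + t)c as (M−r)·Mc + (r+q)·(M+1)c.
  square-split : ∀ M c t →
    (M ∸ t % suc M) * (M * c) + (t % suc M + t / suc M) * (M * c + c) ≡ (M * M + t) * c
  square-split M c t =
    trans (split (t % suc M) (t / suc M) (≤-pred (m%n<n t (suc M))))
          (cong (λ z → (M * M + z) * c) (sym (m≡m%n+[m/n]*n t (suc M))))
    where
    split : ∀ r q → r ≤ M →
      (M ∸ r) * (M * c) + (r + q) * (M * c + c) ≡ (M * M + (r + q * suc M)) * c
    split r q r≤M with m≤n⇒∃[o]m+o≡n r≤M
    ... | o , refl = trans (cong (λ z → z * ((r + o) * c) + (r + q) * ((r + o) * c + c)) (m+n∸m≡n r o))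
                           (identity r o q c)
      where
      identity : ∀ r o q c → o * ((r + o) * c) + (r + q) * ((r + o) * c + c)
                             ≡ ((r + o) * (r + o) + (r + q * suc (r + o))) * c
      identity = solve-∀

  module Submonoid (T : ℕ → Set) (T-zero : T 0) (T-+ : ∀ {a b} → T a → T b → T (a + b)) where

    T-* : ∀ u {a} → T a → T (u * a)
    T-* zero    Ta = T-zero
    T-* (suc u) Ta = T-+ Ta (T-* u Ta)

    T-beyond-square : ∀ M c → T (M * c) → T (M * c + c) → ∀ t → T ((M * M + t) * c)
    T-beyond-square M c TMc TMc+c t =
      subst T (square-split M c t) (T-+ (T-* (M ∸ t % suc M) TMc) (T-* (t % suc M + t / suc M) TMc+c))

  ascending-solvable : ∀ {n} (p : Fin n → ℕ) → Solvable p (dot p toℕ)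
  ascending-solvable p = toℕ , (λ _ _ i<j → i<j) , refl

  eventually-solvable : ∀ {n} (p : Fin n → ℕ) → ∃ λ K → ∀ k → K ≤ k → Solvable p (k * gcdᶠ p)
  eventually-solvable p with consecutive-multiples p
  ... | M , TMc , TMc+c = w + M * M , beyond
    where
    open Submonoid (WeaklySolvable p) (weaklySolvable-zero p) weaklySolvable-+
    c = gcdᶠ p
    open _∣_ (solvable⇒gcdᶠ∣ p (ascending-solvable p)) renaming (quotient to w; equality to S₀≡wc)
    regroup : ∀ w M t c → w * c + (M * M + t) * c ≡ (w + M * M + t) * c
    regroup = solve-∀
    beyond : ∀ k → w + M * M ≤ k → Solvable p (k * c)
    beyond k K≤k with m≤n⇒∃[o]m+o≡n K≤k
    ... | t , refl = subst (Solvable p) (trans (cong (_+ (M * M + t) * c) S₀≡wc) (regroup w M t c))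
                       (solvable-+ (ascending-solvable p) (T-beyond-square M c TMc TMc+c t))

  Extensional : ∀ {n} → ((Fin n → ℕ) → Set) → Set
  Extensional P = ∀ {g h} → (∀ i → g i ≡ h i) → P g → P h

  any-bounded? : ∀ {n} B (P : (Fin n → ℕ) → Set) → Extensional P → (∀ g → Dec (P g)) →
    Dec (∃ λ g → (∀ i → g i < B) × P g)
  any-bounded? {zero} B P ext P? with P? (λ ())
  ... | yes Pg = yes ((λ ()) , (λ ()) , Pg)
  ... | no ¬Pg = no λ (_ , _ , Pg) → ¬Pg (ext (λ ()) Pg)
  any-bounded? {suc n} B P ext P?
    with anyUpTo? (λ a → any-bounded? B (P ∘ (a ∷_)) (ext ∘ ∷-cong) (P? ∘ (a ∷_))) B
    where
    ∷-cong : ∀ {a} {g h : Fin n → ℕ} → (∀ i → g i ≡ h i) → ∀ i → (a ∷ g) i ≡ (a ∷ h) i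
    ∷-cong g≗h fz     = refl
    ∷-cong g≗h (fs i) = g≗h i
  ... | yes (a , a<B , g , g<B , Pag) = yes (a ∷ g , (λ { fz → a<B ; (fs i) → g<B i }) , Pag)
  ... | no ¬∃ = no λ (g , g<B , Pg) → ¬∃ (head g , g<B fz , tail g , g<B ∘ fs , ext η Pg)
    where
    η : ∀ {g : Fin (suc n) → ℕ} i → g i ≡ (head g ∷ tail g) i
    η fz     = refl
    η (fs i) = refl

  strictlyIncreasing? : ∀ {n} (g : Fin n → ℕ) → Dec (StrictlyIncreasing g)
  strictlyIncreasing? g = all? λ i → all? λ j → (i <ᶠ? j) →-dec (g i <? g j)

  solvable? : ∀ {n} (p : Fin n → ℕ) → (∀ i → 0 < p i) → ∀ m → Dec (Solvable p m)
  solvable? p p>0 m =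
    map′ (λ (g , _ , sol) → g , sol) bound
      (any-bounded? (suc m) _ ext (λ g → strictlyIncreasing? g ×-dec (dot p g ≟ m)))
    where
    ext : Extensional (λ g → StrictlyIncreasing g × dot p g ≡ m)
    ext g≗h (inc , eq) =
      (λ i j i<j → subst₂ _<_ (g≗h i) (g≗h j) (inc i j i<j)) , trans (sym (dot-cong p g≗h)) eq
    bound : Solvable p m → ∃ λ g → (∀ i → g i < suc m) × StrictlyIncreasing g × dot p g ≡ m
    bound (g , inc , eq) = g , (λ i → s≤s (subst (g i ≤_) eq (≤-dot p p>0 g i))) , inc , eq

  -- The second entry of a strictly increasing vector is positive.
  ¬solvable-zero : ∀ {n} (p : Fin n → ℕ) → 1 < n → (∀ i → 0 < p i) → ¬ Solvable p 0
  ¬solvable-zero p (s≤s (s≤s z≤n)) p>0 (g , inc , eq) =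
    <-irrefl (sym eq) (<-≤-trans (≤-<-trans z≤n (inc fz (fs fz) z<s)) (≤-dot p p>0 g (fs fz)))

  gcdᶠ-nonZero : ∀ {n} (p : Fin n → ℕ) i → 0 < p i → NonZero (gcdᶠ p)
  gcdᶠ-nonZero p i pᵢ>0 =
    ≢-nonZero λ c≡0 → <⇒≢ pᵢ>0 (sym (0∣⇒≡0 (subst (_∣ p i) c≡0 (gcdᶠ∣ p i))))

  last-failure : ∀ {D : ℕ → Set} → (∀ k → Dec (D k)) → ¬ D 0 → ∀ K → (∀ k → K ≤ k → D k) →
    ∃ λ k₀ → ¬ D k₀ × (∀ k → k₀ < k → D k)
  last-failure D? ¬D0 zero    D≥K = contradiction (D≥K 0 z≤n) ¬D0
  last-failure {D} D? ¬D0 (suc K) D>K with D? K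
  ... | no ¬DK = K , ¬DK , D>K
  ... | yes DK = last-failure D? ¬D0 K D≥K
    where
    D≥K : ∀ k → K ≤ k → D k
    D≥K k K≤k with m≤n⇒m<n∨m≡n K≤k
    ... | inj₁ K<k  = D>K k K<k
    ... | inj₂ refl = DK

  largest-unsolvable-multiple : ∀ {n} (p : Fin n → ℕ) → 1 < n → (∀ i → 0 < p i) →
    ∃ λ k₀ → ¬ Solvable p (k₀ * gcdᶠ p) × (∀ k → k₀ < k → Solvable p (k * gcdᶠ p))
  largest-unsolvable-multiple p n>1 p>0 =
    last-failure (λ k → solvable? p p>0 (k * gcdᶠ p)) (¬solvable-zero p n>1 p>0) _
                 (proj₂ (eventually-solvable p))

open import Defs
open import Data.Nat using (ℕ) renaming (_<_ to _<ℕ_)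
open import Data.Integer using (ℤ; +_; _<_; _≤_)
open import Data.Integer.Divisibility using (_∣_)
open import Data.List using (List)
open import Data.Product using (Σ; _×_)

open import Data.Nat using (suc; _+_; _*_; NonZero)
open import Data.Nat.Properties using (*-cancelʳ-<)
open import Data.Nat.Divisibility using (divides)
open import Data.Nat.GCD using (gcd)
open import Data.Integer using (+<+; _≤?_)
open import Data.Integer.Properties using (≰⇒>; +-injective)
open import Data.List using (tabulate; foldr; map)
open import Data.Nat.ListAction using (sum)
open import Data.Fin using (Fin; fromℕ<) renaming (zero to fz; suc to fs)
open import Data.Product using (_,_)
open import Relation.Nullary using (¬_; yes; no; contradiction)
open import Relation.Binary.PropositionalEquality
open import Function using (_∘_)
open SortingSequences
open WeightedSums

IsThreshold : (ℤ → Set) → ℕ → ℤ → Set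
IsThreshold P c γ = ∀ f → γ < f → + c ∣ f → P f

least-threshold : (P : ℤ → Set) (c : ℕ) .{{_ : NonZero c}} (k₀ : ℕ) →
  ¬ P (+ (k₀ * c)) → (∀ k → k₀ <ℕ k → P (+ (k * c))) →
  (+ c ∣ + (k₀ * c)) × IsThreshold P c (+ (k₀ * c))
    × (∀ γ′ → + c ∣ γ′ → IsThreshold P c γ′ → + (k₀ * c) ≤ γ′)
least-threshold P c k₀ gap beyond = divides k₀ refl , above , least
  where
  above : IsThreshold P c (+ (k₀ * c))
  above (+ m) (+<+ k₀c<m) (divides k m≡kc) =
    subst (P ∘ +_) (sym m≡kc) (beyond k (*-cancelʳ-< c k₀ k (subst (k₀ * c <ℕ_) m≡kc k₀c<m)))
  least : ∀ γ′ → + c ∣ γ′ → IsThreshold P c γ′ → + (k₀ * c) ≤ γ′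
  least γ′ _ γ′-threshold with + (k₀ * c) ≤? γ′
  ... | yes γ≤γ′ = γ≤γ′
  ... | no γ≰γ′  = contradiction (γ′-threshold _ (≰⇒> γ≰γ′) (divides k₀ refl)) gap

weightedSum≡dot : (S : List ℕ) (g : Fin (numValues S) → ℕ) → weightedSum S g ≡ dot (mult S) g
weightedSum≡dot S g = go (mult S) g (λ i → i)
  where
  go : ∀ {k n} (q h : Fin k → ℕ) (f : Fin n → Fin k) →
    sum (map (λ i → q i * h i) (tabulate f)) ≡ dot (q ∘ f) (h ∘ f)
  go {n = 0}     q h f = refl
  go {n = suc n} q h f = cong (λ s → q (f fz) * h (f fz) + s) (go q h (f ∘ fs))

gcdMults≡gcdᶠ : (S : List ℕ) → gcdMults S ≡ gcdᶠ (mult S)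
gcdMults≡gcdᶠ S = go (mult S) (λ i → i)
  where
  go : ∀ {k n} (q : Fin k → ℕ) (f : Fin n → Fin k) →
    foldr (λ i acc → gcd (q i) acc) 0 (tabulate f) ≡ gcdᶠ (q ∘ f)
  go {n = 0}     q f = refl
  go {n = suc n} q f = cong (gcd (q (f fz))) (go q (f ∘ fs))

solvable⇒generalSolution : ∀ S {m} → Solvable (mult S) m → GeneralSolution S (+ m)
solvable⇒generalSolution S (g , inc , eq) = g , inc , cong +_ (trans (weightedSum≡dot S g) eq)

generalSolution⇒solvable : ∀ S {m} → GeneralSolution S (+ m) → Solvable (mult S) m
generalSolution⇒solvable S (g , inc , eq) = g , inc , trans (sym (weightedSum≡dot S g)) (+-injective eq)

mainTheorem20 : (S : List ℕ) → IsSortingSeq S → 1 <ℕ numValues S →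
    Σ ℤ λ γ → (+ gcdMults S ∣ γ)
      × (∀ (f : ℤ) → γ < f → + gcdMults S ∣ f → GeneralSolution S f)
      × (∀ (γ′ : ℤ) → + gcdMults S ∣ γ′
           → (∀ (f : ℤ) → γ′ < f → + gcdMults S ∣ f → GeneralSolution S f)
           → γ ≤ γ′)
mainTheorem20 S sorted r>1 rewrite gcdMults≡gcdᶠ S =
  let k₀ , gap , beyond = largest-unsolvable-multiple p r>1 p>0
  in  + (k₀ * c) , least-threshold (GeneralSolution S) c k₀
                     (gap ∘ generalSolution⇒solvable S) (λ k → solvable⇒generalSolution S ∘ beyond k)
  where
  p = mult S
  p>0 = mult-positive S sorted
  c = gcdᶠ p
  instance
    c-nonZero : NonZero c
    c-nonZero = gcdᶠ-nonZero p (fromℕ< r>1) (p>0 _)
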